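{- For all integers $n, d > 1$, the cooling number of $P_n^{\boxtimes d}$ satisfies $\mathrm{CL}(P_n^{\boxtimes d}) = n$.
   Context: $P_n^{\boxtimes d}$ denotes the $d$-fold strong product of the path on $n$ vertices: its vertex set is $[n]^d$, and distinct vertices $v=(v_1,\dots,v_d)$, $w=(w_1,\dots,w_d)$ are adjacent iff $|v_i-w_i|\le 1$ for all $i$. Cooling process on a graph $G$: initially all vertices are uncooled. In round 1 the player chooses an uncooled vertex (a source) and cools it. In each subsequent round, first every vertex adjacent to a cooled vertex becomes cooled, and then (if uncooled vertices remain) the player chooses an uncooled vertex as a new source and cools it. The process continues until all vertices are cooled. The cooling number $\mathrm{CL}(G)$ is the maximum, over all strategies of the player, of the number of rounds taken to cool $G$. -}

module Defs where

open import Data.Nat using (ℕ; zero; suc; _+_; _≤_; _<_)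
open import Data.Fin using (Fin; toℕ)
open import Data.List using (List; []; _∷_; length)
open import Data.Vec using (Vec; lookup)
open import Data.Maybe using (Maybe; just; nothing)
open import Data.Product using (Σ; _×_; ∃)
open import Data.Sum using (_⊎_)
open import Data.Empty using (⊥)
open import Relation.Nullary using (¬_)
open import Relation.Binary.PropositionalEquality using (_≡_)

-- Source chosen in round (t+1): the t-th element (0-indexed) of the list.
at : {V : Set} → List V → ℕ → Maybe V
at []       _       = nothing
at (x ∷ xs) zero    = just x
at (x ∷ xs) (suc t) = at xs t

module Cooling {V : Set} (Adj : V → V → Set) where

  spread : (V → Set) → (V → Set)
  spread C v = C v ⊎ Σ V (λ w → Adj w v × C w)

  -- Cooled ss t v : vertex v is cooled at the end of round t
  -- (round 0 = before the process starts), when the player's sources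
  -- are ss (the source of round r+1 being the r-th entry of ss).
  Cooled : List V → ℕ → V → Set
  Cooled ss zero    v = ⊥
  Cooled ss (suc t) v = spread (Cooled ss t) v ⊎ (at ss t ≡ just v)

  AllCooled : List V → ℕ → Set
  AllCooled ss t = ∀ v → Cooled ss t v

  -- ss is a complete legal play: each source is uncooled at the moment
  -- it is chosen (after spreading in its round), and once the sources are
  -- exhausted the next spreading step cools everything (so no further
  -- source is ever required).
  CompletePlay : List V → Set
  CompletePlay ss =
    (∀ t → t < length ss → ∀ v → at ss t ≡ just v → ¬ spread (Cooled ss t) v)
    × AllCooled ss (suc (length ss))

  Rounds : List V → ℕ → Set
  Rounds ss T = AllCooled ss T × (∀ r → r < T → ¬ AllCooled ss r)

  CoolingNumberIs : ℕ → Set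
  CoolingNumberIs c =
    ∃ (λ ss → CompletePlay ss × Rounds ss c)
    × (∀ ss T → CompletePlay ss → Rounds ss T → T ≤ c)

StrongPathVertex : ℕ → ℕ → Set
StrongPathVertex n d = Vec (Fin n) d

StrongPathAdj : (n d : ℕ) → StrongPathVertex n d → StrongPathVertex n d → Set
StrongPathAdj n d v w =
  ¬ (v ≡ w) × (∀ i → toℕ (lookup v i) ≤ toℕ (lookup w i) + 1
                × toℕ (lookup w i) ≤ toℕ (lookup v i) + 1)

CL-StrongPath-is : (n d c : ℕ) → Set
CL-StrongPath-is n d c = Cooling.CoolingNumberIs (StrongPathAdj n d) c

-- Upper bound: a vertex at Chebyshev distance k from the first source is
-- cooled by round k + 1, and every vertex of [n]^d is within distance n - 1.
-- Lower bound: choose as (r+1)-th source the vertex (r + ⌊2r/n⌋, 2r mod n, 0, …, 0).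
-- For r < t these sources are more than t - r apart (within a lap the second
-- coordinate moves twice as fast as the round count, across a lap the first
-- coordinate gains one extra step), so each is still uncooled when chosen, and
-- the corner (n-1, …, n-1) stays uncooled until round n.
module Submission where

open import Data.Empty using (⊥-elim)
open import Data.Fin using (Fin; toℕ; fromℕ; fromℕ<; zero; suc)
open import Data.Fin.Properties using (toℕ<n; toℕ≤pred[n]; toℕ-injective; toℕ-fromℕ; toℕ-fromℕ<)
  renaming (_≟_ to _≟ᶠ_)
open import Data.List using (List; []; _∷_; length; applyUpTo)
open import Data.List.Properties using (length-applyUpTo)
open import Data.Maybe using (just)
open import Data.Nat using (ℕ; zero; suc; _+_; _*_; _≤_; _<_; z≤n; s≤s; ≢-nonZero)
open import Data.Nat.DivMod using (_/_; _%_; _mod_; m≡m%n+[m/n]*n; m<n⇒m%n≡m; /-monoˡ-≤; m<n*o⇒m/o<n)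
open import Data.Nat.Properties
open import Algebra.Properties.CommutativeSemigroup +-commutativeSemigroup using (xy∙z≈xz∙y)
open import Data.Product using (Σ; _×_; _,_; proj₁; proj₂; swap)
open import Data.Sum using (inj₁; inj₂)
open import Data.Vec using (Vec; _∷_; lookup; replicate; tabulate)
open import Data.Vec.Properties using (lookup∘tabulate; tabulate∘lookup; tabulate-cong; lookup-replicate; ≡-dec)
open import Function using (_∘_)
open import Relation.Binary.Definitions using (tri<; tri≈; tri>)
open import Relation.Binary.PropositionalEquality
open import Relation.Nullary using (¬_; yes; no)

open import Defs

Close : ℕ → ℕ → ℕ → Set
Close k a b = a ≤ b + k × b ≤ a + k

close-refl : ∀ k a → Close k a a
close-refl k a = m≤m+n a k , m≤m+n a k

close-sym : ∀ {k a b} → Close k a b → Close k b a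
close-sym = swap

close-trans : ∀ {j k a b c} → Close j a b → Close k b c → Close (j + k) a c
close-trans {j} {k} {a} {b} {c} (a≤b+j , b≤a+j) (b≤c+k , c≤b+k) =
  subst (λ m → a ≤ c + m) (+-comm k j) (chain c j k a≤b+j b≤c+k) , chain a k j c≤b+k b≤a+j
  where
  chain : ∀ {x y} z p q → x ≤ y + p → y ≤ z + q → x ≤ z + (q + p)
  chain z p q x≤y+p y≤z+q =
    ≤-trans x≤y+p (≤-trans (+-monoˡ-≤ p y≤z+q) (≤-reflexive (+-assoc z q p)))

close-zero : ∀ {a b} → Close 0 a b → a ≡ b
close-zero {a} {b} (a≤b , b≤a) =
  ≤-antisym (subst (a ≤_) (+-identityʳ b) a≤b) (subst (b ≤_) (+-identityʳ a) b≤a)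

close-bounded : ∀ {N a b} → a ≤ N → b ≤ N → Close N a b
close-bounded {N} {a} {b} a≤N b≤N = ≤-trans a≤N (m≤n+m N b) , ≤-trans b≤N (m≤n+m N a)

close-suc : ∀ a → Close 1 a (suc a)
close-suc a = ≤-trans (n≤1+n a) (m≤m+n (suc a) 1) , ≤-reflexive (+-comm 1 a)

close-step : ∀ {n k a b} → a < n → b < n → Close (suc k) a b →
             Σ ℕ λ c → c < n × Close k a c × Close 1 c b
close-step {k = k} {a} {b} a<n b<n close with <-cmp a b
close-step {k = k} {a} {_} a<n b<n close | tri≈ _ refl _ = a , a<n , close-refl k a , close-refl 1 a
close-step {k = k} {a} {suc c} a<n b<n (_ , b≤a+1+k) | tri< a<b _ _ =
  c , <-trans (n<1+n c) b<n ,
  (≤-trans (≤-pred a<b) (m≤m+n c k) , ≤-pred (subst (suc c ≤_) (+-suc a k) b≤a+1+k)) ,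
  close-suc c
close-step {k = k} {a} {b} a<n b<n (a≤b+1+k , _) | tri> _ _ b<a =
  suc b , ≤-trans (s≤s b<a) a<n ,
  (subst (a ≤_) (+-suc b k) a≤b+1+k , ≤-trans b<a (m≤m+n a k)) ,
  close-sym (close-suc b)

fin-step : ∀ {n k} (a b : Fin n) → Close (suc k) (toℕ a) (toℕ b) →
           Σ (Fin n) λ c → Close k (toℕ a) (toℕ c) × Close 1 (toℕ c) (toℕ b)
fin-step {k = k} a b close with close-step (toℕ<n a) (toℕ<n b) close
... | c , c<n , closes =
  fromℕ< c<n , subst (λ x → Close k (toℕ a) x × Close 1 x (toℕ b)) (sym (toℕ-fromℕ< c<n)) closes

tabulate-choice : ∀ {A : Set} {d} {P : Fin d → A → Set} →
                  (∀ i → Σ A (P i)) → Σ (Vec A d) λ w → ∀ i → P i (lookup w i)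
tabulate-choice {P = P} choose =
  tabulate (proj₁ ∘ choose) ,
  λ i → subst (P i) (sym (lookup∘tabulate (proj₁ ∘ choose) i)) (proj₂ (choose i))

-- Chebyshev distance at most k; StrongPathAdj n d u v is u ≢ v paired with the field of Within 1 u v.
record Within {n d} (k : ℕ) (u v : Vec (Fin n) d) : Set where
  constructor within
  field close : ∀ i → Close k (toℕ (lookup u i)) (toℕ (lookup v i))
open Within

module _ {n d : ℕ} where

  within-refl : ∀ k (u : Vec (Fin n) d) → Within k u u
  within-refl k u = within λ i → close-refl k _

  within-sym : ∀ {k} {u v : Vec (Fin n) d} → Within k u v → Within k v u
  within-sym near = within (close-sym ∘ close near)

  within-trans : ∀ {j k} {u v w : Vec (Fin n) d} → Within j u v → Within k v w → Within (j + k) u w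
  within-trans near₁ near₂ = within λ i → close-trans (close near₁ i) (close near₂ i)

  within-zero : ∀ {u v : Vec (Fin n) d} → Within 0 u v → u ≡ v
  within-zero {u} {v} near = begin
    u                   ≡⟨ sym (tabulate∘lookup u) ⟩
    tabulate (lookup u) ≡⟨ tabulate-cong (toℕ-injective ∘ close-zero ∘ close near) ⟩
    tabulate (lookup v) ≡⟨ tabulate∘lookup v ⟩
    v                   ∎
    where open ≡-Reasoning

  within-step : ∀ {k} {u v : Vec (Fin n) d} → Within (suc k) u v →
                Σ (Vec (Fin n) d) λ w → Within k u w × Within 1 w v
  within-step {u = u} {v} near
    with tabulate-choice (λ i → fin-step (lookup u i) (lookup v i) (close near i))
  ... | w , closes = w , within (proj₁ ∘ closes) , within (proj₂ ∘ closes)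

within-bounded : ∀ {N d} (u v : Vec (Fin (suc N)) d) → Within N u v
within-bounded u v = within λ i → close-bounded (toℕ≤pred[n] (lookup u i)) (toℕ≤pred[n] (lookup v i))

at-applyUpTo : ∀ {A : Set} (f : ℕ → A) m r {v} → at (applyUpTo f m) r ≡ just v → r < m × v ≡ f r
at-applyUpTo f (suc m) zero refl = s≤s z≤n , refl
at-applyUpTo f (suc m) (suc r) at-r with at-applyUpTo (f ∘ suc) m r at-r
... | r<m , refl = s≤s r<m , refl

module CoolingFacts {V : Set} (Adj : V → V → Set) where
  open Cooling Adj

  ¬completePlay[] : V → ¬ CompletePlay []
  ¬completePlay[] v (_ , allCooled) with allCooled v
  ... | inj₁ (inj₁ ())
  ... | inj₁ (inj₂ (_ , _ , ()))
  ... | inj₂ ()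

  rounds≤ : ∀ {ss T c} → Rounds ss T → AllCooled ss c → T ≤ c
  rounds≤ (_ , notYet) allCooled = ≮⇒≥ (λ c<T → notYet _ c<T allCooled)

module StrongPath (N d : ℕ) where

  V : Set
  V = StrongPathVertex (suc N) d

  open Cooling (StrongPathAdj (suc N) d)
  open CoolingFacts (StrongPathAdj (suc N) d)

  Reached : List V → ℕ → V → Set
  Reached ss t v = Σ ℕ λ r → Σ V λ s → Σ ℕ λ k → at ss r ≡ just s × r + k < t × Within k v s

  spread⇒reached : ∀ {ss t v} → spread (Cooled ss t) v →
    Σ ℕ λ r → Σ V λ s → Σ ℕ λ k → at ss r ≡ just s × r < t × r + k ≤ t × Within k v s
  cooled⇒reached : ∀ {ss t v} → Cooled ss t v → Reached ss t v

  spread⇒reached (inj₁ cooled) with cooled⇒reached cooled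
  ... | r , s , k , at-r , r+k<t , near =
    r , s , k , at-r , ≤-<-trans (m≤m+n r k) r+k<t , <⇒≤ r+k<t , near
  spread⇒reached {t = t} (inj₂ (w , (_ , w~v) , cooled)) with cooled⇒reached cooled
  ... | r , s , k , at-r , r+k<t , near =
    r , s , suc k , at-r , ≤-<-trans (m≤m+n r k) r+k<t ,
    subst (_≤ t) (sym (+-suc r k)) r+k<t , within-trans (within-sym (within w~v)) near

  cooled⇒reached {t = suc t} (inj₁ spread-v) with spread⇒reached spread-v
  ... | r , s , k , at-r , _ , r+k≤t , near = r , s , k , at-r , s≤s r+k≤t , near
  cooled⇒reached {t = suc t} (inj₂ at-t) =
    t , _ , 0 , at-t , s≤s (≤-reflexive (+-identityʳ t)) , within-refl 0 _

  cooled-neighbour : ∀ {ss t u v} → Cooled ss t u → Within 1 u v → Cooled ss (suc t) v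
  cooled-neighbour {u = u} {v} cooled near with ≡-dec _≟ᶠ_ u v
  ... | yes refl = inj₁ (inj₁ cooled)
  ... | no u≢v = inj₁ (inj₂ (u , (u≢v , close near) , cooled))

  cooled-within : ∀ {ss t w v} k → Cooled ss t w → Within k w v → Cooled ss (k + t) v
  cooled-within {ss} {t} zero cooled near = subst (Cooled ss t) (within-zero near) cooled
  cooled-within (suc k) cooled near with within-step near
  ... | u , near-u , u~v = cooled-neighbour (cooled-within k cooled near-u) u~v

  allCooled-after-n-rounds : ∀ s ss → AllCooled (s ∷ ss) (suc N)
  allCooled-after-n-rounds s ss v =
    subst (λ t → Cooled (s ∷ ss) t v) (+-comm N 1) (cooled-within N (inj₂ refl) (within-bounded s v))

  rounds≤n : ∀ ss T → CompletePlay ss → Rounds ss T → T ≤ suc N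
  rounds≤n [] T play _ = ⊥-elim (¬completePlay[] (replicate d zero) play)
  rounds≤n (s ∷ ss) T _ rounds = rounds≤ rounds (allCooled-after-n-rounds s ss)

module FoldedSources (N′ d′ : ℕ) where

  N : ℕ
  N = suc N′

  open StrongPath N (suc (suc d′))
  open Cooling (StrongPathAdj (suc N) (suc (suc d′)))

  lap col row : ℕ → ℕ
  lap r = (r + r) / suc N
  col r = r + lap r
  row r = (r + r) % suc N

  row+lap : ∀ r → r + r ≡ row r + lap r * suc N
  row+lap r = m≡m%n+[m/n]*n (r + r) (suc N)

  lap-mono : ∀ {r t} → r ≤ t → lap r ≤ lap t
  lap-mono r≤t = /-monoˡ-≤ (suc N) (+-mono-≤ r≤t r≤t)

  lap≤1 : ∀ {r} → r < suc N → lap r ≤ 1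
  lap≤1 {r} r<n = ≤-pred (m<n*o⇒m/o<n {n = 2}
    (subst (λ x → r + r < suc N + x) (sym (+-identityʳ (suc N))) (+-mono-< r<n r<n)))

  col<n : ∀ {r} → r < N → col r < suc N
  col<n {r} r<N =
    s≤s (≤-trans (+-monoʳ-≤ r (lap≤1 (m<n⇒m<1+n r<N))) (≤-trans (≤-reflexive (+-comm r 1)) r<N))

  double-< : ∀ {r t k} → r < t → t + t ≤ (r + r) + k → t < r + k
  double-< {r} {t} {k} r<t 2t≤2r+k = +-cancelʳ-≤ r (suc t) (r + k) (begin
    suc t + r   ≡⟨ sym (+-suc t r) ⟩
    t + suc r   ≤⟨ +-monoʳ-≤ t r<t ⟩
    t + t       ≤⟨ 2t≤2r+k ⟩
    (r + r) + k ≡⟨ xy∙z≈xz∙y r r k ⟩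
    (r + k) + r ∎)
    where open ≤-Reasoning

  col-row-separated : ∀ {r t k} → r < t → col t ≤ col r + k → row t ≤ row r + k → t < r + k
  col-row-separated {r} {t} {k} r<t col-t row-t with m≤n⇒m<n∨m≡n (lap-mono (<⇒≤ r<t))
  ... | inj₁ lap-r<lap-t = +-cancelʳ-≤ (lap r) (suc t) (r + k) (begin
    suc t + lap r   ≡⟨ sym (+-suc t (lap r)) ⟩
    t + suc (lap r) ≤⟨ +-monoʳ-≤ t lap-r<lap-t ⟩
    col t           ≤⟨ col-t ⟩
    col r + k       ≡⟨ xy∙z≈xz∙y r (lap r) k ⟩
    (r + k) + lap r ∎)
    where open ≤-Reasoning
  ... | inj₂ lap-r≡lap-t = double-< r<t (begin
    t + t                       ≡⟨ row+lap t ⟩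
    row t + lap t * suc N       ≤⟨ +-monoˡ-≤ (lap t * suc N) row-t ⟩
    (row r + k) + lap t * suc N ≡⟨ xy∙z≈xz∙y (row r) k _ ⟩
    (row r + lap t * suc N) + k ≡⟨ cong (λ q → row r + q * suc N + k) (sym lap-r≡lap-t) ⟩
    (row r + lap r * suc N) + k ≡⟨ cong (_+ k) (sym (row+lap r)) ⟩
    (r + r) + k                 ∎)
    where open ≤-Reasoning

  col-row-far : ∀ {r k} → r < suc N → N ≤ col r + k → N ≤ row r + k → N ≤ r + k
  col-row-far {r} {k} r<n N≤col N≤row with lap r ≟ 0
  ... | yes lap≡0 = subst (λ x → N ≤ x + k) (trans (cong (r +_) lap≡0) (+-identityʳ r)) N≤col
  ... | no lap≢0 = ≤-trans N≤row (+-monoˡ-≤ k (<⇒≤ row<r))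
    where
    row<r : row r < r
    row<r = +-cancelʳ-< (suc N) (row r) r (begin-strict
      row r + suc N         ≤⟨ +-monoʳ-≤ (row r) (m≤n*m (suc N) (lap r) {{≢-nonZero lap≢0}}) ⟩
      row r + lap r * suc N ≡⟨ sym (row+lap r) ⟩
      r + r                 <⟨ +-monoʳ-< r r<n ⟩
      r + suc N             ∎)
      where open ≤-Reasoning

  -- The outer mod of the first coordinate only makes source total: col r < n once r < N.
  source : ℕ → V
  source r = col r mod suc N ∷ (r + r) mod suc N ∷ replicate d′ zero

  toℕ-col : ∀ {r} → r < N → toℕ (lookup (source r) zero) ≡ col r
  toℕ-col r<N = trans (toℕ-fromℕ< _) (m<n⇒m%n≡m (col<n r<N))

  toℕ-row : ∀ r → toℕ (lookup (source r) (suc zero)) ≡ row r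
  toℕ-row r = toℕ-fromℕ< _

  corner : V
  corner = replicate _ (fromℕ N)

  toℕ-corner : ∀ i → toℕ (lookup corner i) ≡ N
  toℕ-corner i = trans (cong toℕ (lookup-replicate i (fromℕ N))) (toℕ-fromℕ N)

  sources-separated : ∀ {r t k} → r < t → t < N → Within k (source t) (source r) → t < r + k
  sources-separated {r} {t} {k} r<t t<N near = col-row-separated r<t
    (subst₂ (λ x y → x ≤ y + k) (toℕ-col t<N) (toℕ-col (<-trans r<t t<N)) (proj₁ (close near zero)))
    (subst₂ (λ x y → x ≤ y + k) (toℕ-row t) (toℕ-row r) (proj₁ (close near (suc zero))))

  corner-far : ∀ {r k} → r < N → Within k corner (source r) → N ≤ r + k
  corner-far {r} {k} r<N near = col-row-far (m<n⇒m<1+n r<N)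
    (subst₂ (λ x y → x ≤ y + k) (toℕ-corner zero) (toℕ-col r<N) (proj₁ (close near zero)))
    (subst₂ (λ x y → x ≤ y + k) (toℕ-corner (suc zero)) (toℕ-row r) (proj₁ (close near (suc zero))))

  sources : List V
  sources = applyUpTo source N

  sources-legal : ∀ t → t < length sources → ∀ v → at sources t ≡ just v →
                  ¬ spread (Cooled sources t) v
  sources-legal t _ v at-t spread-v with at-applyUpTo source N t at-t
  ... | t<N , refl with spread⇒reached spread-v
  ... | r , s , k , at-r , r<t , r+k≤t , near with at-applyUpTo source N r at-r
  ... | _ , refl = <⇒≱ (sources-separated r<t t<N near) r+k≤t

  corner-uncooled : ∀ t → t ≤ N → ¬ Cooled sources t corner
  corner-uncooled t t≤N cooled with cooled⇒reached cooled
  ... | r , s , k , at-r , r+k<t , near with at-applyUpTo source N r at-r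
  ... | r<N , refl = <⇒≱ (<-≤-trans r+k<t t≤N) (corner-far r<N near)

  sources-take-n-rounds : Σ (List V) λ ss → CompletePlay ss × Rounds ss (suc N)
  sources-take-n-rounds =
    sources ,
    (sources-legal , subst (λ m → AllCooled sources (suc m)) (sym (length-applyUpTo source N)) allCooled) ,
    allCooled , λ t t<n allCooled-t → corner-uncooled t (≤-pred t<n) (allCooled-t corner)
    where
    allCooled : AllCooled sources (suc N)
    allCooled = allCooled-after-n-rounds (source 0) _

proposition2p1 : (n d : ℕ) → 2 ≤ n → 2 ≤ d → CL-StrongPath-is n d n
proposition2p1 (suc (suc N′)) (suc (suc d′)) (s≤s (s≤s _)) (s≤s (s≤s _)) =
  FoldedSources.sources-take-n-rounds N′ d′ , StrongPath.rounds≤n (suc N′) (suc (suc d′))
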